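{- Let $L$ be any of the fifteen logics of the modal cube and $\mathcal M_L$ its Nmatrix. For every set of formulas $\Gamma$ and formula $\alpha$, if $\Gamma\vdash_L\alpha$ then $\Gamma\models^{\mathcal M_L}\alpha$.
   Context: Syntax and logics. Formulas: $\alpha ::= p \mid \bot \mid \alpha\to\alpha \mid \Box\alpha$ ($p$ in a countable set of propositional variables); $\mathrm{For}$ is the set of formulas; $\neg\alpha:=\alpha\to\bot$, $\Diamond\alpha:=\neg\Box\neg\alpha$, $\wedge,\vee$ the usual classical abbreviations. $\mathbf K$ is axiomatized by classical propositional axioms, (k) $\Box(\alpha\to\beta)\to(\Box\alpha\to\Box\beta)$, modus ponens and necessitation (from $\alpha$ infer $\Box\alpha$). Axiom schemes: (D) $\Box\alpha\to\Diamond\alpha$, (T) $\Box\alpha\to\alpha$, (B) $\alpha\to\Box\Diamond\alpha$, (4) $\Box\alpha\to\Box\Box\alpha$, (5) $\Diamond\alpha\to\Box\Diamond\alpha$. The modal cube: $\mathbf K,\mathbf{KB},\mathbf{K4},\mathbf{K5},\mathbf{K45},\mathbf{KD},\mathbf{KDB},\mathbf{KD4},\mathbf{KD5},\mathbf{KD45},\mathbf{KT},\mathbf{KTB},\mathbf{S4}=\mathbf{KT4},\mathbf{S5}=\mathbf{KTB45},\mathbf{KB5}=\mathbf{KB45}$, each $\mathbf K$ plus the named schemes. $\Gamma\vdash_L\alpha$ means $\alpha$ is a theorem of $L$ or $(\gamma_1\wedge\dots\wedge\gamma_k)\to\alpha$ is a theorem of $L$ for some $\gamma_i\in\Gamma$.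 Truth values: $\mathbf{F},\mathbf{f},\mathbf{f}_2,\mathbf{f}_3,\mathbf{t}_3,\mathbf{t}_2,\mathbf{t},\mathbf{T}$; designated set $\mathcal D=\{\mathbf T,\mathbf t,\mathbf t_2,\mathbf t_3\}$. Nmatrix $\mathcal M_L$. Values $V(L)$: all eight values for $L\in\{\mathbf K,\mathbf{KB},\mathbf{K4},\mathbf{K5},\mathbf{K45}\}$; $\{\mathbf F,\mathbf f,\mathbf f_2,\mathbf t_2,\mathbf t,\mathbf T\}$ for $\mathbf{KB5}$; $\{\mathbf F,\mathbf f,\mathbf f_3,\mathbf t_3,\mathbf t,\mathbf T\}$ for $L\in\{\mathbf{KD},\mathbf{KDB},\mathbf{KD4},\mathbf{KD5},\mathbf{KD45}\}$; $\{\mathbf F,\mathbf f,\mathbf t,\mathbf T\}$ for $L\in\{\mathbf{KT},\mathbf{KTB},\mathbf{S4},\mathbf{S5}\}$. Designated values $V(L)\cap\mathcal D$. Non-deterministic truth functions: $\tilde\bot=\{\mathbf F,\mathbf f_2\}$; $\tilde\to(x,y)$ is given by the following table, restricted to arguments in $V(L)$ (listing, for each $x$, the values for $y=\mathbf F,\mathbf f,\mathbf f_2,\mathbf f_3,\mathbf t_3,\mathbf t_2,\mathbf t,\mathbf T$ in this order): $x=\mathbf F$: $\{\mathbf T\}$ for every $y$; $x=\mathbf f$: $\{\mathbf t\},\{\mathbf T,\mathbf t\},\{\mathbf t_2\},\{\mathbf T\},\{\mathbf t\},\{\mathbf T\},\{\mathbf T,\mathbf t\},\{\mathbf T\}$;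 $x=\mathbf f_2$: $\{\mathbf t_3\},\{\mathbf t\},\{\mathbf t_2\},\{\mathbf T\},\{\mathbf t_3\},\{\mathbf t_2\},\{\mathbf t\},\{\mathbf T\}$; $x=\mathbf f_3$: $\{\mathbf t_3\},\{\mathbf t\},\{\mathbf t_2\},\{\mathbf T\},\{\mathbf t_3\},\{\mathbf t_2\},\{\mathbf t\},\{\mathbf T\}$; $x=\mathbf t_3$: $\{\mathbf f_3\},\{\mathbf f_3\},\{\mathbf f_3\},\{\mathbf f_3\},\{\mathbf T\},\{\mathbf T\},\{\mathbf T\},\{\mathbf T\}$; $x=\mathbf t_2$: $\{\mathbf F\},\{\mathbf f\},\{\mathbf f_2\},\{\mathbf f_3\},\{\mathbf t_3\},\{\mathbf t_2\},\{\mathbf t_3\},\{\mathbf T\}$; $x=\mathbf t$: $\{\mathbf f\},\{\mathbf f,\mathbf f_3\},\{\mathbf f_3\},\{\mathbf f_3\},\{\mathbf t\},\{\mathbf T\},\{\mathbf T,\mathbf t\},\{\mathbf T\}$; $x=\mathbf T$: $\{\mathbf F\},\{\mathbf f\},\{\mathbf f_2\},\{\mathbf f_3\},\{\mathbf t_3\},\{\mathbf t_2\},\{\mathbf t\},\{\mathbf T\}$. $\tilde\Box$ (listed as argument $\mapsto$ output): $\mathbf K$: $\mathbf F,\mathbf f,\mathbf t_3,\mathbf t\mapsto\{\mathbf F,\mathbf f,\mathbf f_3\}$; $\mathbf f_2,\mathbf t_2\mapsto\{\mathbf t_2\}$; $\mathbf f_3,\mathbf T\mapsto\{\mathbf T,\mathbf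 t,\mathbf t_3\}$. $\mathbf{KB}$: $\mathbf F,\mathbf f\mapsto\{\mathbf F\}$; $\mathbf f_2,\mathbf t_2\mapsto\{\mathbf t_2\}$; $\mathbf f_3\mapsto\{\mathbf t_3\}$; $\mathbf t_3,\mathbf t\mapsto\{\mathbf F,\mathbf f,\mathbf f_3\}$; $\mathbf T\mapsto\{\mathbf T,\mathbf t,\mathbf t_3\}$. $\mathbf{K4}$: $\mathbf F,\mathbf f,\mathbf t_3,\mathbf t\mapsto\{\mathbf F,\mathbf f,\mathbf f_3\}$; $\mathbf f_2,\mathbf t_2\mapsto\{\mathbf t_2\}$; $\mathbf f_3,\mathbf T\mapsto\{\mathbf T\}$. $\mathbf{K5}$: $\mathbf F,\mathbf f,\mathbf t_3,\mathbf t\mapsto\{\mathbf F\}$; $\mathbf f_2,\mathbf t_2\mapsto\{\mathbf t_2\}$; $\mathbf f_3,\mathbf T\mapsto\{\mathbf T,\mathbf t_3\}$. $\mathbf{K45}$: $\mathbf F,\mathbf f,\mathbf t_3,\mathbf t\mapsto\{\mathbf F\}$; $\mathbf f_2,\mathbf t_2\mapsto\{\mathbf t_2\}$; $\mathbf f_3,\mathbf T\mapsto\{\mathbf T\}$. $\mathbf{KB5}$: $\mathbf F,\mathbf f,\mathbf t\mapsto\{\mathbf F\}$; $\mathbf f_2,\mathbf t_2\mapsto\{\mathbf t_2\}$; $\mathbf T\mapsto\{\mathbf T\}$. $\mathbf{KD}$: $\mathbf F,\mathbf f,\mathbf t_3,\mathbf t\mapsto\{\mathbf F,\mathbf f,\mathbf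 f_3\}$; $\mathbf f_3,\mathbf T\mapsto\{\mathbf T,\mathbf t,\mathbf t_3\}$. $\mathbf{KDB}$: $\mathbf F,\mathbf f\mapsto\{\mathbf F\}$; $\mathbf f_3\mapsto\{\mathbf t_3\}$; $\mathbf t_3,\mathbf t\mapsto\{\mathbf F,\mathbf f,\mathbf f_3\}$; $\mathbf T\mapsto\{\mathbf T,\mathbf t,\mathbf t_3\}$. $\mathbf{KD4}$: $\mathbf F,\mathbf t_3\mapsto\{\mathbf F\}$; $\mathbf f,\mathbf t\mapsto\{\mathbf F,\mathbf f,\mathbf f_3\}$; $\mathbf f_3,\mathbf T\mapsto\{\mathbf T\}$. $\mathbf{KD5}$: $\mathbf F,\mathbf f,\mathbf t_3,\mathbf t\mapsto\{\mathbf F\}$; $\mathbf f_3,\mathbf T\mapsto\{\mathbf T,\mathbf t_3\}$. $\mathbf{KD45}$: $\mathbf F,\mathbf f,\mathbf t_3,\mathbf t\mapsto\{\mathbf F\}$; $\mathbf f_3,\mathbf T\mapsto\{\mathbf T\}$. $\mathbf{KT}$: $\mathbf F\mapsto\{\mathbf F\}$; $\mathbf f,\mathbf t\mapsto\{\mathbf F,\mathbf f\}$; $\mathbf T\mapsto\{\mathbf T,\mathbf t\}$. $\mathbf{KTB}$: $\mathbf F,\mathbf f\mapsto\{\mathbf F\}$; $\mathbf t\mapsto\{\mathbf F,\mathbf f\}$; $\mathbf T\mapsto\{\mathbf T,\mathbf t\}$. $\mathbf{S4}$: $\mathbf F\mapsto\{\mathbf F\}$; $\mathbf f,\mathbf t\mapsto\{\mathbf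 F,\mathbf f\}$; $\mathbf T\mapsto\{\mathbf T\}$. $\mathbf{S5}$: $\mathbf F,\mathbf f,\mathbf t\mapsto\{\mathbf F\}$; $\mathbf T\mapsto\{\mathbf T\}$. A valuation in $\mathcal M_L$ is a map $v:\mathrm{For}\to V(L)$ with $v(\bot)\in\tilde\bot$, $v(\alpha\to\beta)\in\tilde\to(v(\alpha),v(\beta))$ and $v(\Box\alpha)\in\tilde\Box(v(\alpha))$; $\mathrm{Val}(\mathcal M_L)$ is the set of valuations. Level valuations: $L_0(\mathcal M_L)$ is the set of $v\in\mathrm{Val}(\mathcal M_L)$ such that, if $v(\alpha)\in\{\mathbf f_2,\mathbf t_2\}$ for some $\alpha$, then $v(\beta)\in\{\mathbf f_2,\mathbf t_2\}$ for all $\beta$. $L_{n+1}(\mathcal M_L)=\{v\in L_n(\mathcal M_L)\mid$ for all $\alpha$, if $w(\alpha)\in\mathcal D$ for every $w\in L_n(\mathcal M_L)$, then $v(\alpha)\in\{\mathbf T,\mathbf t_2\}\}$. The set of level-valuations is $L(\mathcal M_L)=\bigcap_{n\ge0}L_n(\mathcal M_L)$. $\Gamma\models^{\mathcal M_L}\alpha$ means: for every $v\in L(\mathcal M_L)$, if $v(\beta)\in\mathcal D$ for all $\beta\in\Gamma$, then $v(\alpha)\in\mathcal D$. -}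

module Defs where

open import Data.Nat using (ℕ; zero; suc)
open import Data.Bool using (Bool; true; false; T)
open import Data.List using (List; []; _∷_)
open import Data.List.Membership.Propositional using (_∈_)
open import Data.List.Relation.Unary.All using (All)
open import Data.Product using (Σ; _×_)
open import Data.Sum using (_⊎_)

infixr 5 _⇒_
data For : Set where
  var : ℕ → For
  ⊥'  : For
  _⇒_ : For → For → For
  □_  : For → For

¬' : For → For
¬' a = a ⇒ ⊥'

◇_ : For → For
◇ a = ¬' (□ (¬' a))

_∧'_ : For → For → For
a ∧' b = ¬' (a ⇒ ¬' b)

conj : For → List For → For
conj g []       = g
conj g (h ∷ hs) = g ∧' conj h hs

data Logic : Set where
  K KB K4 K5 K45 KD KDB KD4 KD5 KD45 KT KTB S4 S5 KB5 : Logic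

hasD hasT hasB has4 has5 : Logic → Bool
hasD KD = true
hasD KDB = true
hasD KD4 = true
hasD KD5 = true
hasD KD45 = true
hasD _ = false

hasT KT = true
hasT KTB = true
hasT S4 = true
hasT S5 = true
hasT _ = false

hasB KB = true
hasB KDB = true
hasB KTB = true
hasB S5 = true
hasB KB5 = true
hasB _ = false

has4 K4 = true
has4 K45 = true
has4 KD4 = true
has4 KD45 = true
has4 S4 = true
has4 S5 = true
has4 KB5 = true   -- KB5 = KB45
has4 _ = false

has5 K5 = true
has5 K45 = true
has5 KD5 = true
has5 KD45 = true
has5 S5 = true
has5 KB5 = true
has5 _ = false

data Thm (L : Logic) : For → Set where
  ax1 : ∀ a b → Thm L (a ⇒ (b ⇒ a))
  ax2 : ∀ a b c → Thm L ((a ⇒ (b ⇒ c)) ⇒ ((a ⇒ b) ⇒ (a ⇒ c)))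
  ax3 : ∀ a → Thm L (¬' (¬' a) ⇒ a)
  axK : ∀ a b → Thm L (□ (a ⇒ b) ⇒ (□ a ⇒ □ b))
  axD : T (hasD L) → ∀ a → Thm L (□ a ⇒ ◇ a)
  axT : T (hasT L) → ∀ a → Thm L (□ a ⇒ a)
  axB : T (hasB L) → ∀ a → Thm L (a ⇒ □ (◇ a))
  ax4 : T (has4 L) → ∀ a → Thm L (□ a ⇒ □ (□ a))
  ax5 : T (has5 L) → ∀ a → Thm L (◇ a ⇒ □ (◇ a))
  mp  : ∀ {a b} → Thm L (a ⇒ b) → Thm L a → Thm L b
  nec : ∀ {a} → Thm L a → Thm L (□ a)

_⊢[_]_ : (For → Set) → Logic → For → Set
Γ ⊢[ L ] α = Thm L α ⊎
  Σ For λ g → Σ (List For) λ gs → Γ g × All Γ gs × Thm L (conj g gs ⇒ α)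

data Val : Set where
  vF vf vf2 vf3 vt3 vt2 vt vT : Val

data Des : Val → Set where
  dT  : Des vT
  dt  : Des vt
  dt2 : Des vt2
  dt3 : Des vt3

inV : Logic → Val → Bool
inV KB5 vf3 = false
inV KB5 vt3 = false
inV KD  vf2 = false
inV KD  vt2 = false
inV KDB vf2 = false
inV KDB vt2 = false
inV KD4 vf2 = false
inV KD4 vt2 = false
inV KD5 vf2 = false
inV KD5 vt2 = false
inV KD45 vf2 = false
inV KD45 vt2 = false
inV KT vF = true
inV KT vf = true
inV KT vt = true
inV KT vT = true
inV KT _ = false
inV KTB vF = true
inV KTB vf = true
inV KTB vt = true
inV KTB vT = true
inV KTB _ = false
inV S4 vF = true
inV S4 vf = true
inV S4 vt = true
inV S4 vT = true
inV S4 _ = false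
inV S5 vF = true
inV S5 vf = true
inV S5 vt = true
inV S5 vT = true
inV S5 _ = false
inV _ _ = true

botT : List Val
botT = vF ∷ vf2 ∷ []

impT : Val → Val → List Val
impT vF _ = vT ∷ []
impT vf vF  = vt ∷ []
impT vf vf  = vT ∷ vt ∷ []
impT vf vf2 = vt2 ∷ []
impT vf vf3 = vT ∷ []
impT vf vt3 = vt ∷ []
impT vf vt2 = vT ∷ []
impT vf vt  = vT ∷ vt ∷ []
impT vf vT  = vT ∷ []
impT vf2 vF  = vt3 ∷ []
impT vf2 vf  = vt ∷ []
impT vf2 vf2 = vt2 ∷ []
impT vf2 vf3 = vT ∷ []
impT vf2 vt3 = vt3 ∷ []
impT vf2 vt2 = vt2 ∷ []
impT vf2 vt  = vt ∷ []
impT vf2 vT  = vT ∷ []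
impT vf3 vF  = vt3 ∷ []
impT vf3 vf  = vt ∷ []
impT vf3 vf2 = vt2 ∷ []
impT vf3 vf3 = vT ∷ []
impT vf3 vt3 = vt3 ∷ []
impT vf3 vt2 = vt2 ∷ []
impT vf3 vt  = vt ∷ []
impT vf3 vT  = vT ∷ []
impT vt3 vF  = vf3 ∷ []
impT vt3 vf  = vf3 ∷ []
impT vt3 vf2 = vf3 ∷ []
impT vt3 vf3 = vf3 ∷ []
impT vt3 vt3 = vT ∷ []
impT vt3 vt2 = vT ∷ []
impT vt3 vt  = vT ∷ []
impT vt3 vT  = vT ∷ []
impT vt2 vF  = vF ∷ []
impT vt2 vf  = vf ∷ []
impT vt2 vf2 = vf2 ∷ []
impT vt2 vf3 = vf3 ∷ []
impT vt2 vt3 = vt3 ∷ []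
impT vt2 vt2 = vt2 ∷ []
impT vt2 vt  = vt3 ∷ []
impT vt2 vT  = vT ∷ []
impT vt vF  = vf ∷ []
impT vt vf  = vf ∷ vf3 ∷ []
impT vt vf2 = vf3 ∷ []
impT vt vf3 = vf3 ∷ []
impT vt vt3 = vt ∷ []
impT vt vt2 = vT ∷ []
impT vt vt  = vT ∷ vt ∷ []
impT vt vT  = vT ∷ []
impT vT vF  = vF ∷ []
impT vT vf  = vf ∷ []
impT vT vf2 = vf2 ∷ []
impT vT vf3 = vf3 ∷ []
impT vT vt3 = vt3 ∷ []
impT vT vt2 = vt2 ∷ []
impT vT vt  = vt ∷ []
impT vT vT  = vT ∷ []

lowK : List Val
lowK = vF ∷ vf ∷ vf3 ∷ []
highK : List Val
highK = vT ∷ vt ∷ vt3 ∷ []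
only : Val → List Val
only x = x ∷ []

-- □̃ for each logic.  Arguments outside V(L) are never reached by a
-- valuation (which maps into V(L)); they are sent to the empty set.
boxT : Logic → Val → List Val
boxT K vF = lowK
boxT K vf = lowK
boxT K vt3 = lowK
boxT K vt = lowK
boxT K vf2 = only vt2
boxT K vt2 = only vt2
boxT K vf3 = highK
boxT K vT = highK
boxT KB vF = only vF
boxT KB vf = only vF
boxT KB vf2 = only vt2
boxT KB vt2 = only vt2
boxT KB vf3 = only vt3
boxT KB vt3 = lowK
boxT KB vt = lowK
boxT KB vT = highK
boxT K4 vF = lowK
boxT K4 vf = lowK
boxT K4 vt3 = lowK
boxT K4 vt = lowK
boxT K4 vf2 = only vt2
boxT K4 vt2 = only vt2
boxT K4 vf3 = only vT
boxT K4 vT = only vT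
boxT K5 vF = only vF
boxT K5 vf = only vF
boxT K5 vt3 = only vF
boxT K5 vt = only vF
boxT K5 vf2 = only vt2
boxT K5 vt2 = only vt2
boxT K5 vf3 = vT ∷ vt3 ∷ []
boxT K5 vT = vT ∷ vt3 ∷ []
boxT K45 vF = only vF
boxT K45 vf = only vF
boxT K45 vt3 = only vF
boxT K45 vt = only vF
boxT K45 vf2 = only vt2
boxT K45 vt2 = only vt2
boxT K45 vf3 = only vT
boxT K45 vT = only vT
boxT KB5 vF = only vF
boxT KB5 vf = only vF
boxT KB5 vt = only vF
boxT KB5 vf2 = only vt2
boxT KB5 vt2 = only vt2
boxT KB5 vT = only vT
boxT KB5 _ = []
boxT KD vF = lowK
boxT KD vf = lowK
boxT KD vt3 = lowK
boxT KD vt = lowK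
boxT KD vf3 = highK
boxT KD vT = highK
boxT KD _ = []
boxT KDB vF = only vF
boxT KDB vf = only vF
boxT KDB vf3 = only vt3
boxT KDB vt3 = lowK
boxT KDB vt = lowK
boxT KDB vT = highK
boxT KDB _ = []
boxT KD4 vF = only vF
boxT KD4 vt3 = only vF
boxT KD4 vf = lowK
boxT KD4 vt = lowK
boxT KD4 vf3 = only vT
boxT KD4 vT = only vT
boxT KD4 _ = []
boxT KD5 vF = only vF
boxT KD5 vf = only vF
boxT KD5 vt3 = only vF
boxT KD5 vt = only vF
boxT KD5 vf3 = vT ∷ vt3 ∷ []
boxT KD5 vT = vT ∷ vt3 ∷ []
boxT KD5 _ = []
boxT KD45 vF = only vF
boxT KD45 vf = only vF
boxT KD45 vt3 = only vF
boxT KD45 vt = only vF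
boxT KD45 vf3 = only vT
boxT KD45 vT = only vT
boxT KD45 _ = []
boxT KT vF = only vF
boxT KT vf = vF ∷ vf ∷ []
boxT KT vt = vF ∷ vf ∷ []
boxT KT vT = vT ∷ vt ∷ []
boxT KT _ = []
boxT KTB vF = only vF
boxT KTB vf = only vF
boxT KTB vt = vF ∷ vf ∷ []
boxT KTB vT = vT ∷ vt ∷ []
boxT KTB _ = []
boxT S4 vF = only vF
boxT S4 vf = vF ∷ vf ∷ []
boxT S4 vt = vF ∷ vf ∷ []
boxT S4 vT = only vT
boxT S4 _ = []
boxT S5 vF = only vF
boxT S5 vf = only vF
boxT S5 vt = only vF
boxT S5 vT = only vT
boxT S5 _ = []

record IsValuation (L : Logic) (v : For → Val) : Set where
  field
    inRange : ∀ a → T (inV L (v a))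
    vBot    : v ⊥' ∈ botT
    vImp    : ∀ a b → v (a ⇒ b) ∈ impT (v a) (v b)
    vBox    : ∀ a → v (□ a) ∈ boxT L (v a)

data Two : Val → Set where
  twoF : Two vf2
  twoT : Two vt2

data TopT2 : Val → Set where
  topT : TopT2 vT
  topt2 : TopT2 vt2

Level : Logic → ℕ → (For → Val) → Set
Level L zero v =
  IsValuation L v × (∀ a → Two (v a) → ∀ b → Two (v b))
Level L (suc n) v =
  Level L n v ×
  (∀ a → (∀ (w : For → Val) → Level L n w → Des (w a)) → TopT2 (v a))

LevelValuation : Logic → (For → Val) → Set
LevelValuation L v = ∀ n → Level L n v

_⊨[_]_ : (For → Set) → Logic → For → Set
Γ ⊨[ L ] α = ∀ (v : For → Val) → LevelValuation L v →
  (∀ b → Γ b → Des (v b)) → Des (v α)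

{-# OPTIONS --safe #-}
module Submission where

-- Under any valuation of 𝓜_L, designation behaves classically: v (α ⇒ β) is
-- designated iff designation of v α implies that of v β, and v ⊥' never is.
-- Moreover each set □̃ x is either entirely designated or entirely undesignated,
-- the former exactly when x ∈ {f₂, f₃, t₂, T} (Necessary x), uniformly in L.
-- Every axiom thereby reduces to a finite property of the tables, checked
-- exhaustively, so it is designated by every valuation. Modus ponens preserves designation; for
-- necessitation, a formula designated throughout Lₙ takes value T or t₂ on
-- Lₙ₊₁, and both are Necessary.

open import Defs
open import Data.Bool using (T)
open import Data.Empty using (⊥-elim)
open import Data.Fin using (#_)
open import Data.List using (List; []; _∷_)
open import Data.List.Membership.Propositional using (_∈_)
open import Data.List.Membership.Propositional.Properties using (∈-lookup)
open import Data.List.Relation.Unary.All as All using (All; []; _∷_; all?)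
open import Data.Nat using (ℕ; suc; _⊔_; _≤_; z≤n; _≤′_; ≤′-refl; ≤′-step)
open import Data.Nat.Properties using (≤⇒≤′; m≤m⊔n; m≤n⊔m)
open import Data.Product using (∃; _,_; proj₁; uncurry)
open import Data.Sum using (inj₁; inj₂)
open import Function using (_∘_; _⇔_; mk⇔; Equivalence)
open import Relation.Nullary using (Dec; yes; no; ¬_)
open import Relation.Nullary.Decidable
  using (map′; _×-dec_; _→-dec_; from-yes; decidable-stable; T?)
open import Relation.Unary using (Decidable)

∀?-enumeration : {A : Set} {P : A → Set} (xs : List A) → (∀ x → x ∈ xs) →
                 Decidable P → Dec (∀ x → P x)
∀?-enumeration xs complete P? =
  map′ (λ ps x → All.lookup ps (complete x)) (λ f → All.tabulate λ {x} _ → f x)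
       (all? P? xs)

values : List Val
values = vF ∷ vf ∷ vf2 ∷ vf3 ∷ vt3 ∷ vt2 ∷ vt ∷ vT ∷ []

∈-values : ∀ x → x ∈ values
∈-values vF  = ∈-lookup (# 0)
∈-values vf  = ∈-lookup (# 1)
∈-values vf2 = ∈-lookup (# 2)
∈-values vf3 = ∈-lookup (# 3)
∈-values vt3 = ∈-lookup (# 4)
∈-values vt2 = ∈-lookup (# 5)
∈-values vt  = ∈-lookup (# 6)
∈-values vT  = ∈-lookup (# 7)

logics : List Logic
logics = K ∷ KB ∷ K4 ∷ K5 ∷ K45 ∷ KD ∷ KDB ∷ KD4 ∷ KD5 ∷ KD45 ∷ KT ∷ KTB ∷ S4 ∷ S5 ∷ KB5 ∷ []

∈-logics : ∀ L → L ∈ logics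
∈-logics K    = ∈-lookup (# 0)
∈-logics KB   = ∈-lookup (# 1)
∈-logics K4   = ∈-lookup (# 2)
∈-logics K5   = ∈-lookup (# 3)
∈-logics K45  = ∈-lookup (# 4)
∈-logics KD   = ∈-lookup (# 5)
∈-logics KDB  = ∈-lookup (# 6)
∈-logics KD4  = ∈-lookup (# 7)
∈-logics KD5  = ∈-lookup (# 8)
∈-logics KD45 = ∈-lookup (# 9)
∈-logics KT   = ∈-lookup (# 10)
∈-logics KTB  = ∈-lookup (# 11)
∈-logics S4   = ∈-lookup (# 12)
∈-logics S5   = ∈-lookup (# 13)
∈-logics KB5  = ∈-lookup (# 14)

∀Val? : {P : Val → Set} → Decidable P → Dec (∀ x → P x)
∀Val? = ∀?-enumeration values ∈-values

∀Logic? : {P : Logic → Set} → Decidable P → Dec (∀ L → P L)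
∀Logic? = ∀?-enumeration logics ∈-logics

_⇔?_ : {A B : Set} → Dec A → Dec B → Dec (A ⇔ B)
a? ⇔? b? = map′ (uncurry mk⇔) (λ e → Equivalence.to e , Equivalence.from e)
                ((a? →-dec b?) ×-dec (b? →-dec a?))

Des? : Decidable Des
Des? vF  = no λ ()
Des? vf  = no λ ()
Des? vf2 = no λ ()
Des? vf3 = no λ ()
Des? vt3 = yes dt3
Des? vt2 = yes dt2
Des? vt  = yes dt
Des? vT  = yes dT

data Necessary : Val → Set where
  nf2 : Necessary vf2
  nf3 : Necessary vf3
  nt2 : Necessary vt2
  nT  : Necessary vT

Necessary? : Decidable Necessary
Necessary? vF  = no λ ()
Necessary? vf  = no λ ()
Necessary? vf2 = yes nf2
Necessary? vf3 = yes nf3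
Necessary? vt3 = no λ ()
Necessary? vt2 = yes nt2
Necessary? vt  = no λ ()
Necessary? vT  = yes nT

TopT2⇒Necessary : ∀ {x} → TopT2 x → Necessary x
TopT2⇒Necessary topT  = nT
TopT2⇒Necessary topt2 = nt2

-- P holds of every value the tables allow for ◇ a when v a = x and v ⊥' = b.
◇All : Logic → Val → (Val → Set) → Val → Set
◇All L b P x = All (λ n → All (λ y → All P (impT y b)) (boxT L n)) (impT x b)

◇All? : ∀ L b {P} → Decidable P → Decidable (◇All L b P)
◇All? L b P? x = all? (λ n → all? (λ y → all? P? (impT y b)) (boxT L n)) (impT x b)

impT-designation : ∀ x y → All (λ z → Des z ⇔ (Des x → Des y)) (impT x y)
impT-designation = from-yes (∀Val? λ x → ∀Val? λ y →
  all? (λ z → Des? z ⇔? (Des? x →-dec Des? y)) (impT x y))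

botT-undesignated : All (λ b → ¬ Des b) botT
botT-undesignated = (λ ()) ∷ (λ ()) ∷ []

boxT-designation : ∀ L x → All (λ y → Des y ⇔ Necessary x) (boxT L x)
boxT-designation = from-yes (∀Logic? λ L → ∀Val? λ x →
  all? (λ y → Des? y ⇔? Necessary? x) (boxT L x))

Necessary-mp : ∀ x y → All (λ z → Necessary z → Necessary x → Necessary y) (impT x y)
Necessary-mp = from-yes (∀Val? λ x → ∀Val? λ y →
  all? (λ z → Necessary? z →-dec Necessary? x →-dec Necessary? y) (impT x y))

Necessary⇒◇Des : ∀ L → T (hasD L) → All (λ b → ∀ x → Necessary x → ◇All L b Des x) botT
Necessary⇒◇Des = from-yes (∀Logic? λ L → T? (hasD L) →-dec
  all? (λ b → ∀Val? λ x → Necessary? x →-dec ◇All? L b Des? x) botT)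

Necessary⇒Des : ∀ L → T (hasT L) → ∀ x → T (inV L x) → Necessary x → Des x
Necessary⇒Des = from-yes (∀Logic? λ L → T? (hasT L) →-dec
  ∀Val? λ x → T? (inV L x) →-dec Necessary? x →-dec Des? x)

Des⇒◇Necessary : ∀ L → T (hasB L) → All (λ b → ∀ x → Des x → ◇All L b Necessary x) botT
Des⇒◇Necessary = from-yes (∀Logic? λ L → T? (hasB L) →-dec
  all? (λ b → ∀Val? λ x → Des? x →-dec ◇All? L b Necessary? x) botT)

Necessary⇒□Necessary : ∀ L → T (has4 L) → ∀ x → Necessary x → All Necessary (boxT L x)
Necessary⇒□Necessary = from-yes (∀Logic? λ L → T? (has4 L) →-dec
  ∀Val? λ x → Necessary? x →-dec all? Necessary? (boxT L x))

◇Des⇒Necessary : ∀ L → T (has5 L) →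
  All (λ b → ∀ x → ◇All L b (λ d → Des d → Necessary d) x) botT
◇Des⇒Necessary = from-yes (∀Logic? λ L → T? (has5 L) →-dec
  all? (λ b → ∀Val? λ x → ◇All? L b (λ d → Des? d →-dec Necessary? d) x) botT)

module Designation {L : Logic} {v : For → Val} (isv : IsValuation L v) where
  open IsValuation isv

  ⇒-designated : ∀ a b → Des (v (a ⇒ b)) ⇔ (Des (v a) → Des (v b))
  ⇒-designated a b = All.lookup (impT-designation (v a) (v b)) (vImp a b)

  ⇒-intro : ∀ {a b} → (Des (v a) → Des (v b)) → Des (v (a ⇒ b))
  ⇒-intro {a} {b} = Equivalence.from (⇒-designated a b)

  ⇒-elim : ∀ {a b} → Des (v (a ⇒ b)) → Des (v a) → Des (v b)
  ⇒-elim {a} {b} = Equivalence.to (⇒-designated a b)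

  ⊥-undesignated : ¬ Des (v ⊥')
  ⊥-undesignated = All.lookup botT-undesignated vBot

  □-designated : ∀ a → Des (v (□ a)) ⇔ Necessary (v a)
  □-designated a = All.lookup (boxT-designation L (v a)) (vBox a)

  □-intro : ∀ {a} → Necessary (v a) → Des (v (□ a))
  □-intro {a} = Equivalence.from (□-designated a)

  □-elim : ∀ {a} → Des (v (□ a)) → Necessary (v a)
  □-elim {a} = Equivalence.to (□-designated a)

  ◇All-elim : ∀ {P} a → ◇All L (v ⊥') P (v a) → P (v (◇ a))
  ◇All-elim a h =
    All.lookup (All.lookup (All.lookup h (vImp a ⊥')) (vBox (¬' a))) (vImp (□ ¬' a) ⊥')

  ax1-designated : ∀ a b → Des (v (a ⇒ (b ⇒ a)))
  ax1-designated a b = ⇒-intro λ da → ⇒-intro λ _ → da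

  ax2-designated : ∀ a b c → Des (v ((a ⇒ (b ⇒ c)) ⇒ ((a ⇒ b) ⇒ (a ⇒ c))))
  ax2-designated a b c =
    ⇒-intro λ abc → ⇒-intro λ ab → ⇒-intro λ da → ⇒-elim (⇒-elim abc da) (⇒-elim ab da)

  ax3-designated : ∀ a → Des (v (¬' (¬' a) ⇒ a))
  ax3-designated a = ⇒-intro λ nna → decidable-stable (Des? (v a)) λ na →
    ⊥-undesignated (⇒-elim nna (⇒-intro λ da → ⊥-elim (na da)))

  axK-designated : ∀ a b → Des (v (□ (a ⇒ b) ⇒ (□ a ⇒ □ b)))
  axK-designated a b = ⇒-intro λ □ab → ⇒-intro λ □a →
    □-intro (All.lookup (Necessary-mp (v a) (v b)) (vImp a b) (□-elim □ab) (□-elim □a))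

  axD-designated : T (hasD L) → ∀ a → Des (v (□ a ⇒ ◇ a))
  axD-designated serial a = ⇒-intro λ □a →
    ◇All-elim a (All.lookup (Necessary⇒◇Des L serial) vBot (v a) (□-elim □a))

  axT-designated : T (hasT L) → ∀ a → Des (v (□ a ⇒ a))
  axT-designated reflexive a = ⇒-intro λ □a →
    Necessary⇒Des L reflexive (v a) (inRange a) (□-elim □a)

  axB-designated : T (hasB L) → ∀ a → Des (v (a ⇒ □ (◇ a)))
  axB-designated symmetric a = ⇒-intro λ da →
    □-intro (◇All-elim a (All.lookup (Des⇒◇Necessary L symmetric) vBot (v a) da))

  ax4-designated : T (has4 L) → ∀ a → Des (v (□ a ⇒ □ (□ a)))
  ax4-designated transitive a = ⇒-intro λ □a →
    □-intro (All.lookup (Necessary⇒□Necessary L transitive (v a) (□-elim □a)) (vBox a))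

  ax5-designated : T (has5 L) → ∀ a → Des (v (◇ a ⇒ □ (◇ a)))
  ax5-designated euclidean a = ⇒-intro λ ◇a →
    □-intro (◇All-elim a (All.lookup (◇Des⇒Necessary L euclidean) vBot (v a)) ◇a)

  ∧-intro : ∀ {a b} → Des (v a) → Des (v b) → Des (v (a ∧' b))
  ∧-intro da db = ⇒-intro λ a⇒¬b → ⇒-elim (⇒-elim a⇒¬b da) db

  conj-designated : ∀ {g gs} → Des (v g) → All (Des ∘ v) gs → Des (v (conj g gs))
  conj-designated dg []         = dg
  conj-designated dg (dh ∷ dhs) = ∧-intro dg (conj-designated dh dhs)

Level-antitone : ∀ {L w m n} → m ≤′ n → Level L n w → Level L m w
Level-antitone ≤′-refl         l       = l
Level-antitone (≤′-step m≤′n) (l , _) = Level-antitone m≤′n l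

Level⇒IsValuation : ∀ {L w} n → Level L n w → IsValuation L w
Level⇒IsValuation n = proj₁ ∘ Level-antitone (≤⇒≤′ z≤n)

Valid : Logic → ℕ → For → Set
Valid L n α = ∀ w → Level L n w → Des (w α)

Valid-mono : ∀ {L m n α} → m ≤ n → Valid L m α → Valid L n α
Valid-mono m≤n valid w = valid w ∘ Level-antitone (≤⇒≤′ m≤n)

valid₀ : ∀ {L α} → (∀ {w} → IsValuation L w → Des (w α)) → Valid L 0 α
valid₀ designated w (isv , _) = designated isv

sound : ∀ {L α} → Thm L α → ∃ λ n → Valid L n α
sound (ax1 a b)   = 0 , valid₀ λ isv → Designation.ax1-designated isv a b
sound (ax2 a b c) = 0 , valid₀ λ isv → Designation.ax2-designated isv a b c
sound (ax3 a)     = 0 , valid₀ λ isv → Designation.ax3-designated isv a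
sound (axK a b)   = 0 , valid₀ λ isv → Designation.axK-designated isv a b
sound (axD h a)   = 0 , valid₀ λ isv → Designation.axD-designated isv h a
sound (axT h a)   = 0 , valid₀ λ isv → Designation.axT-designated isv h a
sound (axB h a)   = 0 , valid₀ λ isv → Designation.axB-designated isv h a
sound (ax4 h a)   = 0 , valid₀ λ isv → Designation.ax4-designated isv h a
sound (ax5 h a)   = 0 , valid₀ λ isv → Designation.ax5-designated isv h a
sound (mp ⊢a⇒b ⊢a) with sound ⊢a⇒b | sound ⊢a
... | m , valid-a⇒b | n , valid-a = m ⊔ n , λ w l →
  Designation.⇒-elim (Level⇒IsValuation (m ⊔ n) l)
    (Valid-mono (m≤m⊔n m n) valid-a⇒b w l) (Valid-mono (m≤n⊔m m n) valid-a w l)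
sound (nec ⊢a) with sound ⊢a
... | n , valid-a = suc n , λ w (l , valid⇒top) →
  Designation.□-intro (Level⇒IsValuation n l) (TopT2⇒Necessary (valid⇒top _ valid-a))

theorem1 : (L : Logic) (Γ : For → Set) (α : For) → Γ ⊢[ L ] α → Γ ⊨[ L ] α
theorem1 L Γ α (inj₁ ⊢α) v level _ with sound ⊢α
... | n , valid-α = valid-α v (level n)
theorem1 L Γ α (inj₂ (g , gs , Γg , Γgs , ⊢conj⇒α)) v level Γ-designated with sound ⊢conj⇒α
... | n , valid = ⇒-elim (valid v (level n))
                    (conj-designated (Γ-designated g Γg) (All.map (Γ-designated _) Γgs))
  where open Designation (Level⇒IsValuation 0 (level 0))
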